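{- Let $n\ge 1$, let $a_i,b_i\in\mathbb{R}$ $(1\le i\le n)$ and $p_i,q_i\in\mathbb{R}$ $(1\le i\le n-1)$, and put $A_i=\begin{bmatrix} a_i & b_i\\ b_i & a_i\end{bmatrix}$, assumed nonsingular for each $i$. Let $J_2$ be the $2\times 2$ all-ones matrix and $O_2$ the $2\times2$ zero matrix, and let $T_n\in\mathbb{R}^{2n\times 2n}$ be the block tridiagonal matrix with diagonal blocks $A_1,\dots,A_n$, superdiagonal blocks $p_1J_2,\dots,p_{n-1}J_2$, subdiagonal blocks $q_1J_2,\dots,q_{n-1}J_2$, and all other blocks $O_2$. Let $g_n=\det T_n$. Then \[g_n=\tilde h_n\prod_{i=1}^n(a_i-b_i),\] where $\tilde h_n$ is the determinant of the $n\times n$ tridiagonal matrix with diagonal entries $a_1+b_1,\dots,a_n+b_n$, superdiagonal entries $2p_1,\dots,2p_{n-1}$ and subdiagonal entries $2q_1,\dots,2q_{n-1}$. Moreover $\tilde h_0=1$, $\tilde h_1=a_1+b_1$, and for $n\ge 2$, \[\tilde h_n=(a_n+b_n)\tilde h_{n-1}-4p_{n-1}q_{n-1}\tilde h_{n-2}.\] -}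

module Defs where

open import Level using (Level)
open import Algebra.Bundles using (CommutativeRing)
open import Data.Nat as ℕ using (ℕ; zero; suc; _≡ᵇ_; _/_; _%_)
open import Data.Fin as Fin using (Fin; toℕ; punchIn)
open import Data.Bool using (if_then_else_)

-- Everything is parametrised by a commutative ring R (standing in for ℝ).
module _ {c ℓ : Level} (R : CommutativeRing c ℓ) where
  open CommutativeRing R renaming (Carrier to C)

  Mat : ℕ → Set c
  Mat n = Fin n → Fin n → C

  sumFin : (n : ℕ) → (Fin n → C) → C
  sumFin zero    f = 0#
  sumFin (suc n) f = f Fin.zero + sumFin n (λ i → f (Fin.suc i))

  prodTo : ℕ → (ℕ → C) → C
  prodTo zero    f = 1#
  prodTo (suc n) f = prodTo n f * f n

  altSign : ℕ → C
  altSign zero    = 1#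
  altSign (suc k) = - altSign k

  det : (n : ℕ) → Mat n → C
  det zero    M = 1#
  det (suc n) M =
    sumFin (suc n) (λ j → altSign (toℕ j) * M Fin.zero j
                            * det n (λ r s → M (Fin.suc r) (punchIn j s)))

  two : C
  two = 1# + 1#

  four : C
  four = two * two

  -- n×n tridiagonal matrix (0-based indices): diagonal d 0..d(n-1),
  -- superdiagonal u 0..u(n-2) (entry (i,i+1) is u i),
  -- subdiagonal l 0..l(n-2) (entry (j+1,j) is l j), zero elsewhere.
  triEntry : (d u l : ℕ → C) → ℕ → ℕ → C
  triEntry d u l i j =
    if i ≡ᵇ j then d i
    else if j ≡ᵇ suc i then u i
    else if i ≡ᵇ suc j then l j
    else 0#

  tridiag : (n : ℕ) → (d u l : ℕ → C) → Mat n
  tridiag n d u l i j = triEntry d u l (toℕ i) (toℕ j)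

  -- The 2n×2n block tridiagonal matrix T_n (0-based block indices):
  -- diagonal blocks A_i = [[a i, b i],[b i, a i]], superdiagonal blocks p i J₂
  -- (block (i,i+1)), subdiagonal blocks q j J₂ (block (j+1,j)), O₂ elsewhere.
  -- Row/column index r of Fin (n * 2) lies in block r / 2 at position r % 2.
  blockEntry : (a b p q : ℕ → C) → ℕ → ℕ → C
  blockEntry a b p q r s =
    let bi = r / 2 ; bj = s / 2 in
    if bi ≡ᵇ bj then (if (r % 2) ≡ᵇ (s % 2) then a bi else b bi)
    else if bj ≡ᵇ suc bi then p bi
    else if bi ≡ᵇ suc bj then q bj
    else 0#

  Tmat : (n : ℕ) → (a b p q : ℕ → C) → Mat (n ℕ.* 2)
  Tmat n a b p q r s = blockEntry a b p q (toℕ r) (toℕ s)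

  gdet : (n : ℕ) → (a b p q : ℕ → C) → C
  gdet n a b p q = det (n ℕ.* 2) (Tmat n a b p q)

  htilde : (n : ℕ) → (a b p q : ℕ → C) → C
  htilde n a b p q =
    det n (tridiag n (λ i → a i + b i) (λ i → two * p i) (λ i → two * q i))

{-# OPTIONS --safe #-}
module Submission where

-- Subtracting the second row of T from the first leaves (a₁ − b₁, b₁ − a₁, 0, …, 0), so
-- g_n = (a₁ − b₁)(det M₁ + det M₂), where M_j deletes row 1 and column j. Columns 1 and 2
-- of T agree below the first block, so M₁ and M₂ differ only in their first row and
-- det M₁ + det M₂ = det N, where N has first row (a₁ + b₁, 2p₁, 2p₁, 0, …). Expanding along
-- it, the first minor is T with its first block deleted, and the other two yield to the same
-- row reduction applied to the second block; altogether
--   g_n = (a₁ − b₁) ((a₁ + b₁) g′ − 4 p₁ q₁ (a₂ − b₂) g″),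
-- with g′, g″ the determinants of T with its first one, resp. two, blocks deleted. This is the
-- first-row recurrence of h̃ multiplied by ∏ (a_i − b_i), so induction gives g_n = h̃_n ∏ (a_i − b_i);
-- the last-row recurrence of h̃ follows from the first-row one by induction. Nothing is
-- inverted, so all of this holds over any commutative ring, without the nonsingularity hypothesis.

open import Defs
open import Level using (Level)
open import Algebra.Bundles using (CommutativeRing)
open import Algebra.Solver.Ring.AlmostCommutativeRing using (fromCommutativeRing; _-Raw-AlmostCommutative⟶_)
open import Data.Maybe using (Maybe; just; nothing)
open import Data.Nat as ℕ using (ℕ; zero; suc; _≤_; _<_; _/_; _%_; _≡ᵇ_; s≤s; z≤n)
open import Data.Nat.DivMod using (m/n≡1+[m∸n]/n)
import Data.Nat.Properties as ℕ
open import Data.Integer as ℤ using (ℤ; +_; -[1+_]; _⊖_)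
import Data.Integer.Properties as ℤ
open import Data.Sign as Sign using (Sign)
open import Data.Fin as Fin using (Fin; zero; suc; toℕ; punchIn)
open import Data.Vec.Functional using (_∷_; tail; zipWith)
open import Data.Bool using (if_then_else_)
open import Data.Product using (_×_; _,_)
open import Function using (_∘_)
open import Relation.Binary.Core using (_Preserves_⟶_)
open import Relation.Binary.PropositionalEquality as ≡ using (_≡_; _≗_)
open import Relation.Nullary using (¬_; yes; no)

shift : ∀ {a} {A : Set a} → (ℕ → A) → ℕ → A
shift f = f ∘ suc

[2+m]/2≡1+m/2 : ∀ m → (2 ℕ.+ m) / 2 ≡ suc (m / 2)
[2+m]/2≡1+m/2 m = m/n≡1+[m∸n]/n {2 ℕ.+ m} (s≤s (s≤s z≤n))

[4+m]/2≡2+m/2 : ∀ m → (4 ℕ.+ m) / 2 ≡ 2 ℕ.+ m / 2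
[4+m]/2≡2+m/2 m = ≡.trans ([2+m]/2≡1+m/2 (2 ℕ.+ m)) (≡.cong suc ([2+m]/2≡1+m/2 m))

-- The ring solver needs coefficients with decidable equality: ℤ maps into every commutative
-- ring, whereas with coefficients in R itself 1# - 1# would not normalise to 0#.
module IntegerCoefficients {c ℓ : Level} (R : CommutativeRing c ℓ) where
  open CommutativeRing R
  open import Algebra.Properties.Ring ring using (-‿involutive; -‿+-comm; -1*x≈-x; -0#≈0#)
  open import Algebra.Properties.CommutativeSemigroup +-commutativeSemigroup using (interchange)
  open import Algebra.Properties.CommutativeSemigroup *-commutativeSemigroup
    using () renaming (interchange to *-interchange)
  open import Algebra.Properties.Semiring.Mult.TCOptimised semiring using (1+×; ×-homo-+; ×1-homo-*)
    renaming (_×_ to _·_)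
  open import Relation.Binary.Reasoning.Setoid setoid

  private
    ⟦_⟧ : ℤ → Carrier
    ⟦ + n ⟧      = n · 1#
    ⟦ -[1+ n ] ⟧ = - (suc n · 1#)

    1+x-[1+y]≈x-y : ∀ x y → (1# + x) - (1# + y) ≈ x - y
    1+x-[1+y]≈x-y x y = begin
      (1# + x) + - (1# + y)     ≈⟨ +-congˡ (-‿+-comm 1# y) ⟨
      (1# + x) + (- 1# + - y)   ≈⟨ interchange 1# x (- 1#) (- y) ⟩
      (1# - 1#) + (x - y)       ≈⟨ +-congʳ (-‿inverseʳ 1#) ⟩
      0# + (x - y)              ≈⟨ +-identityˡ (x - y) ⟩
      x - y                     ∎

    ⊖-homo : ∀ m n → ⟦ m ⊖ n ⟧ ≈ m · 1# - n · 1#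
    ⊖-homo m       zero    = sym (trans (+-congˡ -0#≈0#) (+-identityʳ _))
    ⊖-homo zero    (suc n) = sym (+-identityˡ _)
    ⊖-homo (suc m) (suc n) = begin
      ⟦ suc m ⊖ suc n ⟧               ≡⟨ ≡.cong ⟦_⟧ (ℤ.[1+m]⊖[1+n]≡m⊖n m n) ⟩
      ⟦ m ⊖ n ⟧                       ≈⟨ ⊖-homo m n ⟩
      m · 1# - n · 1#                 ≈⟨ 1+x-[1+y]≈x-y _ _ ⟨
      (1# + m · 1#) - (1# + n · 1#)   ≈⟨ +-cong (1+× m 1#) (-‿cong (1+× n 1#)) ⟨
      suc m · 1# - suc n · 1#         ∎

    +-homo : ∀ i j → ⟦ i ℤ.+ j ⟧ ≈ ⟦ i ⟧ + ⟦ j ⟧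
    +-homo (+ m)    (+ n)    = ×-homo-+ 1# m n
    +-homo (+ m)    -[1+ n ] = ⊖-homo m (suc n)
    +-homo -[1+ m ] (+ n)    = trans (⊖-homo n (suc m)) (+-comm _ _)
    +-homo -[1+ m ] -[1+ n ] = begin
      - (suc (suc (m ℕ.+ n)) · 1#)      ≡⟨ ≡.cong (λ k → - (suc k · 1#)) (ℕ.+-suc m n) ⟨
      - ((suc m ℕ.+ suc n) · 1#)        ≈⟨ -‿cong (×-homo-+ 1# (suc m) (suc n)) ⟩
      - (suc m · 1# + suc n · 1#)       ≈⟨ -‿+-comm _ _ ⟨
      - (suc m · 1#) + - (suc n · 1#)   ∎

    sign : Sign → Carrier
    sign Sign.+ = 1#
    sign Sign.- = - 1#

    sign-homo : ∀ s t → sign (s Sign.* t) ≈ sign s * sign t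
    sign-homo Sign.+ t      = sym (*-identityˡ _)
    sign-homo Sign.- Sign.+ = sym (*-identityʳ _)
    sign-homo Sign.- Sign.- = sym (trans (-1*x≈-x _) (-‿involutive 1#))

    ◃-homo : ∀ s n → ⟦ s ℤ.◃ n ⟧ ≈ sign s * n · 1#
    ◃-homo s      zero    = sym (zeroʳ _)
    ◃-homo Sign.+ (suc n) = sym (*-identityˡ _)
    ◃-homo Sign.- (suc n) = sym (-1*x≈-x _)

    sign*abs : ∀ i → ⟦ i ⟧ ≈ sign (ℤ.sign i) * ℤ.∣ i ∣ · 1#
    sign*abs (+ n)    = sym (*-identityˡ _)
    sign*abs -[1+ n ] = sym (-1*x≈-x _)

    *-homo : ∀ i j → ⟦ i ℤ.* j ⟧ ≈ ⟦ i ⟧ * ⟦ j ⟧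
    *-homo i j = begin
      ⟦ i ℤ.* j ⟧
        ≈⟨ ◃-homo (ℤ.sign i Sign.* ℤ.sign j) (ℤ.∣ i ∣ ℕ.* ℤ.∣ j ∣) ⟩
      sign (ℤ.sign i Sign.* ℤ.sign j) * (ℤ.∣ i ∣ ℕ.* ℤ.∣ j ∣) · 1#
        ≈⟨ *-cong (sign-homo (ℤ.sign i) (ℤ.sign j)) (×1-homo-* ℤ.∣ i ∣ ℤ.∣ j ∣) ⟩
      (sign (ℤ.sign i) * sign (ℤ.sign j)) * (ℤ.∣ i ∣ · 1# * ℤ.∣ j ∣ · 1#)
        ≈⟨ *-interchange _ _ _ _ ⟩
      (sign (ℤ.sign i) * ℤ.∣ i ∣ · 1#) * (sign (ℤ.sign j) * ℤ.∣ j ∣ · 1#)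
        ≈⟨ *-cong (sign*abs i) (sign*abs j) ⟨
      ⟦ i ⟧ * ⟦ j ⟧
        ∎

    -‿homo : ∀ i → ⟦ ℤ.- i ⟧ ≈ - ⟦ i ⟧
    -‿homo (+ zero)  = sym -0#≈0#
    -‿homo (+ suc n) = refl
    -‿homo -[1+ n ]  = sym (-‿involutive _)

    ⟦⟧-homomorphism : ℤ.+-*-rawRing -Raw-AlmostCommutative⟶ fromCommutativeRing R
    ⟦⟧-homomorphism = record
      { ⟦_⟧ = ⟦_⟧ ; +-homo = +-homo ; *-homo = *-homo ; -‿homo = -‿homo ; 0-homo = refl ; 1-homo = refl }

    _≟⟦⟧_ : ∀ i j → Maybe (⟦ i ⟧ ≈ ⟦ j ⟧)
    i ≟⟦⟧ j with i ℤ.≟ j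
    ... | yes i≡j = just (reflexive (≡.cong ⟦_⟧ i≡j))
    ... | no  _   = nothing

  open import Algebra.Solver.Ring ℤ.+-*-rawRing (fromCommutativeRing R) ⟦⟧-homomorphism _≟⟦⟧_ public

module Laplace {c ℓ : Level} (R : CommutativeRing c ℓ) where
  open CommutativeRing R renaming (Carrier to C) hiding (zero)
  open IntegerCoefficients R
  open import Algebra.Properties.CommutativeSemigroup +-commutativeSemigroup using (interchange)
  open import Algebra.Properties.Ring ring using (-‿+-comm; -0#≈0#)
  open import Algebra.Properties.Group +-group using (x≈y⇒x∙y⁻¹≈ε)
  open import Relation.Binary.Reasoning.Setoid setoid

  sumFin-cong : ∀ n {f g : Fin n → C} → (∀ i → f i ≈ g i) → sumFin R n f ≈ sumFin R n g
  sumFin-cong zero    f≈g = refl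
  sumFin-cong (suc n) f≈g = +-cong (f≈g zero) (sumFin-cong n (f≈g ∘ suc))

  sumFin-≈0 : ∀ n {f : Fin n → C} → (∀ i → f i ≈ 0#) → sumFin R n f ≈ 0#
  sumFin-≈0 zero    f≈0 = refl
  sumFin-≈0 (suc n) f≈0 = trans (+-cong (f≈0 zero) (sumFin-≈0 n (f≈0 ∘ suc))) (+-identityʳ 0#)

  sumFin-distrib-+ : ∀ n (f g : Fin n → C) → sumFin R n (zipWith _+_ f g) ≈ sumFin R n f + sumFin R n g
  sumFin-distrib-+ zero    f g = sym (+-identityʳ 0#)
  sumFin-distrib-+ (suc n) f g = trans (+-congˡ (sumFin-distrib-+ n (f ∘ suc) (g ∘ suc))) (interchange _ _ _ _)

  *-distribˡ-sumFin : ∀ n x (f : Fin n → C) → x * sumFin R n f ≈ sumFin R n (λ i → x * f i)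
  *-distribˡ-sumFin zero    x f = zeroʳ x
  *-distribˡ-sumFin (suc n) x f = trans (distribˡ x _ _) (+-congˡ (*-distribˡ-sumFin n x (f ∘ suc)))

  -‿distrib-sumFin : ∀ n (f : Fin n → C) → - sumFin R n f ≈ sumFin R n (λ i → - f i)
  -‿distrib-sumFin zero    f = -0#≈0#
  -‿distrib-sumFin (suc n) f = trans (sym (-‿+-comm _ _)) (+-congˡ (-‿distrib-sumFin n (f ∘ suc)))

  sign : ∀ {n} → Fin n → C
  sign j = altSign R (toℕ j)

  minor : ∀ {n} → Mat R (suc n) → Fin (suc n) → Mat R n
  minor M j r s = M (suc r) (punchIn j s)

  laplaceTerm : ∀ {n} → Mat R (suc n) → Fin (suc n) → C
  laplaceTerm {n} M j = sign j * M zero j * det R n (minor M j)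

  laplaceTerm-≈0 : ∀ {n} (M : Mat R (suc n)) j → M zero j ≈ 0# → laplaceTerm M j ≈ 0#
  laplaceTerm-≈0 M j M₀ⱼ≈0 = trans (*-congʳ (trans (*-congˡ M₀ⱼ≈0) (zeroʳ _))) (zeroˡ _)

  det-cong : ∀ n {M N : Mat R n} → (∀ r s → M r s ≈ N r s) → det R n M ≈ det R n N
  det-cong zero    M≈N = refl
  det-cong (suc n) {M} {N} M≈N = sumFin-cong (suc n) {laplaceTerm M} {laplaceTerm N} λ j →
    *-cong (*-congˡ (M≈N zero j)) (det-cong n λ r s → M≈N (suc r) (punchIn j s))

  mutual
    det-expandColumn₀ : ∀ n (M : Mat R (suc n)) → (∀ r → M (suc r) zero ≈ 0#) →
                        det R (suc n) M ≈ M zero zero * det R n (minor M zero)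
    det-expandColumn₀ n M column₀≈0 =
      trans (+-cong (*-congʳ (*-identityˡ _)) (sumFin-≈0 n (laterTerms-≈0 n M column₀≈0)))
            (+-identityʳ _)

    det-zeroColumn₀ : ∀ n (M : Mat R (suc n)) → (∀ r → M r zero ≈ 0#) → det R (suc n) M ≈ 0#
    det-zeroColumn₀ n M column₀≈0 =
      trans (det-expandColumn₀ n M (column₀≈0 ∘ suc)) (trans (*-congʳ (column₀≈0 zero)) (zeroˡ _))

    private
      laterTerms-≈0 : ∀ n (M : Mat R (suc n)) → (∀ r → M (suc r) zero ≈ 0#) → ∀ j →
                      laplaceTerm M (suc j) ≈ 0#
      laterTerms-≈0 (suc n) M column₀≈0 j =
        trans (*-congˡ (det-zeroColumn₀ n (minor M (suc j)) column₀≈0)) (zeroʳ _)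

  det-+-row₀ : ∀ n (u v : Fin (suc n) → C) (M : Fin n → Fin (suc n) → C) →
               det R (suc n) (zipWith _+_ u v ∷ M) ≈ det R (suc n) (u ∷ M) + det R (suc n) (v ∷ M)
  det-+-row₀ n u v M =
    trans (sumFin-cong (suc n) λ j → distribʳ-term (sign j) (u j) (v j) (det R n (minor (u ∷ M) j)))
          (sumFin-distrib-+ (suc n) (laplaceTerm (u ∷ M)) (laplaceTerm (v ∷ M)))
    where
    distribʳ-term : ∀ s x y d → s * (x + y) * d ≈ s * x * d + s * y * d
    distribʳ-term = solve 4 (λ s x y d → s :* (x :+ y) :* d := s :* x :* d :+ s :* y :* d) refl

  -- det R (2 + m) M unfolds to
  -- doubleExpansion m (M zero) (M (suc zero)) (λ σ → det R m (λ r s → M (2 + r) (σ s))).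
  doubleExpansion : ∀ m → (v w : Fin (2 ℕ.+ m) → C) → ((Fin m → Fin (2 ℕ.+ m)) → C) → C
  doubleExpansion m v w Φ = sumFin R (2 ℕ.+ m) λ j → sign j * v j *
    sumFin R (suc m) λ k → sign k * w (punchIn j k) * Φ (punchIn j ∘ punchIn k)

  -- Terms deleting the same pair of columns cancel; the induction step cancels the pairs that
  -- delete column zero and leaves a smaller double expansion.
  doubleExpansion-≈0 : ∀ m v w Φ → Φ Preserves _≗_ ⟶ _≈_ → (∀ i → v i ≈ w i) →
                       doubleExpansion m v w Φ ≈ 0#
  doubleExpansion-≈0 zero v w Φ Φ-resp v≈w = begin
    1# * v zero * (1# * w₁ * Φ₁ + 0#) + (- 1# * v₁ * (1# * w zero * Φ₀ + 0#) + 0#)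
      ≈⟨ +-cong (*-congʳ (*-congˡ (v≈w zero)))
                (+-congʳ (*-cong (*-congˡ (v≈w (suc zero))) (+-congʳ (*-congˡ (Φ-resp λ ()))))) ⟩
    1# * w zero * (1# * w₁ * Φ₁ + 0#) + (- 1# * w₁ * (1# * w zero * Φ₁ + 0#) + 0#)
      ≈⟨ cancel (w zero) w₁ Φ₁ ⟩
    0# ∎
    where
    v₁ = v (suc zero)
    w₁ = w (suc zero)
    Φ₀ = Φ (punchIn (suc zero) ∘ punchIn zero)
    Φ₁ = Φ (punchIn zero ∘ punchIn zero)
    cancel : ∀ x y f → 1# * x * (1# * y * f + 0#) + (- 1# * y * (1# * x * f + 0#) + 0#) ≈ 0#
    cancel = solve 3 (λ x y f → con (+ 1) :* x :* (con (+ 1) :* y :* f :+ con (+ 0))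
                       :+ (:- con (+ 1) :* y :* (con (+ 1) :* x :* f :+ con (+ 0)) :+ con (+ 0)) := con (+ 0)) refl
  doubleExpansion-≈0 (suc m) v w Φ Φ-resp v≈w = begin
    1# * v zero * sumFin R (2 ℕ.+ m) A + sumFin R (2 ℕ.+ m) (λ j → - sign j * v′ j * inner j)
      ≈⟨ +-congˡ (sumFin-cong (2 ℕ.+ m) split) ⟩
    1# * v zero * sumFin R (2 ℕ.+ m) A + sumFin R (2 ℕ.+ m) (zipWith _+_ P Q)
      ≈⟨ +-congˡ (sumFin-distrib-+ (2 ℕ.+ m) P Q) ⟩
    1# * v zero * sumFin R (2 ℕ.+ m) A + (sumFin R (2 ℕ.+ m) P + doubleExpansion m v′ w′ Φ′)
      ≈⟨ +-congˡ (trans (+-congˡ (doubleExpansion-≈0 m v′ w′ Φ′ Φ′-resp (v≈w ∘ suc))) (+-identityʳ _)) ⟩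
    1# * v zero * sumFin R (2 ℕ.+ m) A + sumFin R (2 ℕ.+ m) P
      ≈⟨ +-congʳ (*-distribˡ-sumFin (2 ℕ.+ m) (1# * v zero) A) ⟩
    sumFin R (2 ℕ.+ m) (λ k → 1# * v zero * A k) + sumFin R (2 ℕ.+ m) P
      ≈⟨ sumFin-distrib-+ (2 ℕ.+ m) (λ k → 1# * v zero * A k) P ⟨
    sumFin R (2 ℕ.+ m) (λ k → 1# * v zero * A k + P k)
      ≈⟨ sumFin-≈0 (2 ℕ.+ m) cancel ⟩
    0# ∎
    where
    v′ w′ : Fin (2 ℕ.+ m) → C
    v′ = v ∘ suc
    w′ = w ∘ suc
    Φ′ : (Fin m → Fin (2 ℕ.+ m)) → C
    Φ′ τ = Φ (Fin.lift 1 τ)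
    Φ′-resp : Φ′ Preserves _≗_ ⟶ _≈_
    Φ′-resp σ≗τ = Φ-resp λ { zero → ≡.refl ; (suc s) → ≡.cong suc (σ≗τ s) }
    B Z : Fin (2 ℕ.+ m) → C
    B j = Φ (suc ∘ punchIn j)
    Z j = sumFin R (suc m) λ k → sign k * w′ (punchIn j k) * Φ′ (punchIn j ∘ punchIn k)
    A P Q : Fin (2 ℕ.+ m) → C
    A k = sign k * w′ k * B k
    P j = - (sign j * v′ j * w zero * B j)
    Q j = sign j * v′ j * Z j
    inner : Fin (2 ℕ.+ m) → C
    inner j = sumFin R (2 ℕ.+ m) λ k → sign k * w (punchIn (suc j) k) * Φ (punchIn (suc j) ∘ punchIn k)

    inner-split : ∀ j → inner j ≈ 1# * w zero * B j - Z j
    inner-split j = +-congˡ (begin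
      sumFin R (suc m) Zₖ⁻              ≈⟨ sumFin-cong (suc m) {Zₖ⁻} {λ k → - Zₖ k} Zₖ⁻≈-Zₖ ⟩
      sumFin R (suc m) (λ k → - Zₖ k)   ≈⟨ -‿distrib-sumFin (suc m) Zₖ ⟨
      - Z j                             ∎)
      where
      Zₖ Zₖ⁻ : Fin (suc m) → C
      Zₖ k = sign k * w′ (punchIn j k) * Φ′ (punchIn j ∘ punchIn k)
      Zₖ⁻ k = - sign k * w′ (punchIn j k) * Φ (punchIn (suc j) ∘ punchIn (suc k))
      Zₖ⁻≈-Zₖ : ∀ k → Zₖ⁻ k ≈ - Zₖ k
      Zₖ⁻≈-Zₖ k = trans (*-congˡ (Φ-resp λ { zero → ≡.refl ; (suc s) → ≡.refl }))
                        (solve 3 (λ s x f → :- s :* x :* f := :- (s :* x :* f)) refl _ _ _)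

    split : ∀ j → - sign j * v′ j * inner j ≈ P j + Q j
    split j = trans (*-congˡ (inner-split j)) (distribute _ _ _ _ _)
      where
      distribute : ∀ s x y b z → - s * x * (1# * y * b - z) ≈ - (s * x * y * b) + s * x * z
      distribute = solve 5 (λ s x y b z → :- s :* x :* (con (+ 1) :* y :* b :- z)
                                        := :- (s :* x :* y :* b) :+ s :* x :* z) refl

    cancel : ∀ k → 1# * v zero * A k + P k ≈ 0#
    cancel k = begin
      1# * v zero * (sign k * w′ k * B k) - sign k * v′ k * w zero * B k
        ≈⟨ +-congˡ (-‿cong (*-congʳ (*-cong (*-congˡ (v≈w (suc k))) (sym (v≈w zero))))) ⟩
      1# * v zero * (sign k * w′ k * B k) - sign k * w′ k * v zero * B k
        ≈⟨ solve 4 (λ x y s b → con (+ 1) :* x :* (s :* y :* b) :- s :* y :* x :* b := con (+ 0)) refl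
                   (v zero) (w′ k) (sign k) (B k) ⟩
      0# ∎

  det-equalRows : ∀ m (M : Mat R (2 ℕ.+ m)) → (∀ s → M zero s ≈ M (suc zero) s) →
                  det R (2 ℕ.+ m) M ≈ 0#
  det-equalRows m M =
    doubleExpansion-≈0 m (M zero) (M (suc zero)) (λ σ → det R m λ r s → M (suc (suc r)) (σ s))
      λ σ≗τ → det-cong m λ r s → reflexive (≡.cong (M (suc (suc r))) (σ≗τ s))

  det-expand₂ : ∀ m (M : Mat R (2 ℕ.+ m)) → (∀ s → M zero (suc (suc s)) ≈ 0#) →
                det R (2 ℕ.+ m) M ≈ M zero zero * det R (suc m) (minor M zero)
                                    - M zero (suc zero) * det R (suc m) (minor M (suc zero))
  det-expand₂ m M row₀≈0 =
    trans (+-congˡ (+-congˡ (sumFin-≈0 m λ s → laplaceTerm-≈0 M (suc (suc s)) (row₀≈0 s))))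
          (simplify _ _ _ _)
    where
    simplify : ∀ x y d e → 1# * x * d + (- 1# * y * e + 0#) ≈ x * d - y * e
    simplify = solve 4 (λ x y d e → con (+ 1) :* x :* d :+ (:- con (+ 1) :* y :* e :+ con (+ 0))
                                    := x :* d :- y :* e) refl

  det-expand₃ : ∀ m (M : Mat R (3 ℕ.+ m)) → (∀ s → M zero (suc (suc (suc s))) ≈ 0#) →
                det R (3 ℕ.+ m) M ≈ M zero zero * det R (2 ℕ.+ m) (minor M zero)
                                    - M zero (suc zero) * det R (2 ℕ.+ m) (minor M (suc zero))
                                    + M zero (suc (suc zero)) * det R (2 ℕ.+ m) (minor M (suc (suc zero)))
  det-expand₃ m M row₀≈0 =
    trans (+-congˡ (+-congˡ (+-congˡ (sumFin-≈0 m λ s → laplaceTerm-≈0 M (suc (suc (suc s))) (row₀≈0 s)))))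
          (simplify _ _ _ _ _ _)
    where
    simplify : ∀ x y z d e f → 1# * x * d + (- 1# * y * e + (- (- 1#) * z * f + 0#)) ≈ x * d - y * e + z * f
    simplify = solve 6 (λ x y z d e f →
      con (+ 1) :* x :* d :+ (:- con (+ 1) :* y :* e :+ (:- (:- con (+ 1)) :* z :* f :+ con (+ 0)))
        := x :* d :- y :* e :+ z :* f) refl

  det-subtractRow₁ : ∀ m (M : Mat R (2 ℕ.+ m)) →
    (∀ s → M zero (suc (suc s)) ≈ M (suc zero) (suc (suc s))) →
    det R (2 ℕ.+ m) M ≈ (M zero zero - M (suc zero) zero) * det R (suc m) (minor M zero)
                        - (M zero (suc zero) - M (suc zero) (suc zero)) * det R (suc m) (minor M (suc zero))
  det-subtractRow₁ m M rows₀₁≈ = begin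
    det R (2 ℕ.+ m) M
      ≈⟨ det-cong (2 ℕ.+ m) {M} {zipWith _+_ difference (M (suc zero)) ∷ tail M}
                  (λ { zero s → x≈x-y+y _ _ ; (suc r) s → refl }) ⟩
    det R (2 ℕ.+ m) (zipWith _+_ difference (M (suc zero)) ∷ tail M)
      ≈⟨ det-+-row₀ (suc m) difference (M (suc zero)) (tail M) ⟩
    det R (2 ℕ.+ m) (difference ∷ tail M) + det R (2 ℕ.+ m) (M (suc zero) ∷ tail M)
      ≈⟨ +-congˡ (det-equalRows m (M (suc zero) ∷ tail M) λ s → refl) ⟩
    det R (2 ℕ.+ m) (difference ∷ tail M) + 0#
      ≈⟨ +-identityʳ _ ⟩
    det R (2 ℕ.+ m) (difference ∷ tail M)
      ≈⟨ det-expand₂ m (difference ∷ tail M) (λ s → x≈y⇒x∙y⁻¹≈ε (rows₀₁≈ s)) ⟩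
    _ ∎
    where
    difference : Fin (2 ℕ.+ m) → C
    difference = zipWith _-_ (M zero) (M (suc zero))
    x≈x-y+y : ∀ x y → x ≈ (x - y) + y
    x≈x-y+y = solve 2 (λ x y → x := (x :- y) :+ y) refl

  det-nearlyEqualRows : ∀ m (M : Mat R (2 ℕ.+ m)) →
    M zero zero ≈ M (suc zero) zero →
    (∀ s → M zero (suc (suc s)) ≈ M (suc zero) (suc (suc s))) →
    (∀ r → M (suc (suc r)) zero ≈ 0#) →
    det R (2 ℕ.+ m) M ≈ (M (suc zero) (suc zero) - M zero (suc zero)) * M (suc zero) zero
                         * det R m (λ r s → M (suc (suc r)) (suc (suc s)))
  det-nearlyEqualRows m M column₀≈ rows₀₁≈ column₀≈0 = begin
    det R (2 ℕ.+ m) M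
      ≈⟨ det-subtractRow₁ m M rows₀₁≈ ⟩
    (M zero zero - M (suc zero) zero) * det R (suc m) (minor M zero) - (x - y) * det R (suc m) (minor M (suc zero))
      ≈⟨ +-cong (*-congʳ (x≈y⇒x∙y⁻¹≈ε column₀≈))
                (-‿cong (*-congˡ (det-expandColumn₀ m (minor M (suc zero)) column₀≈0))) ⟩
    0# * det R (suc m) (minor M zero) - (x - y) * (M (suc zero) zero * D)
      ≈⟨ simplify _ _ _ _ _ ⟩
    (y - x) * M (suc zero) zero * D ∎
    where
    x = M zero (suc zero)
    y = M (suc zero) (suc zero)
    D = det R m (λ r s → M (suc (suc r)) (suc (suc s)))
    simplify : ∀ d x y z e → 0# * d - (x - y) * (z * e) ≈ (y - x) * z * e
    simplify = solve 5 (λ d x y z e → con (+ 0) :* d :- (x :- y) :* (z :* e) := (y :- x) :* z :* e) refl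

module Tridiagonal {c ℓ : Level} (R : CommutativeRing c ℓ) where
  open CommutativeRing R renaming (Carrier to C) hiding (zero)
  open IntegerCoefficients R
  open Laplace R
  open import Relation.Binary.Reasoning.Setoid setoid

  triDet : ℕ → (d u l : ℕ → C) → C
  triDet n d u l = det R n (tridiag R n d u l)

  triDet-1 : ∀ d u l → triDet 1 d u l ≈ d 0
  triDet-1 d u l = trans (+-identityʳ _) (trans (*-identityʳ _) (*-identityˡ _))

  triDet-expandFirst : ∀ n d u l →
    triDet (2 ℕ.+ n) d u l ≈ d 0 * triDet (suc n) (shift d) (shift u) (shift l)
                              - u 0 * l 0 * triDet n (shift (shift d)) (shift (shift u)) (shift (shift l))
  triDet-expandFirst n d u l = begin
    triDet (2 ℕ.+ n) d u l
      ≈⟨ det-expand₂ n M (λ s → refl) ⟩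
    d 0 * det R (suc n) (minor M zero) - u 0 * det R (suc n) (minor M (suc zero))
      ≈⟨ +-congˡ (-‿cong (*-congˡ (det-expandColumn₀ n (minor M (suc zero)) λ r → refl))) ⟩
    d 0 * det R (suc n) (minor M zero) - u 0 * (l 0 * det R n (minor (minor M (suc zero)) zero))
      ≈⟨ +-congˡ (-‿cong (*-assoc _ _ _)) ⟨
    _ ∎
    where
    M = tridiag R (2 ℕ.+ n) d u l

  triDet-2 : ∀ d u l → triDet 2 d u l ≈ d 0 * d 1 - u 0 * l 0
  triDet-2 d u l = trans (triDet-expandFirst 0 d u l)
                         (+-cong (*-congˡ (triDet-1 (shift d) (shift u) (shift l))) (-‿cong (*-identityʳ _)))

  triDet-expandLast : ∀ n d u l →
    triDet (2 ℕ.+ n) d u l ≈ d (suc n) * triDet (suc n) d u l - u n * l n * triDet n d u l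
  triDet-expandLast zero d u l = begin
    triDet 2 d u l                         ≈⟨ triDet-2 d u l ⟩
    d 0 * d 1 - u 0 * l 0                  ≈⟨ +-cong (*-comm _ _) (-‿cong (*-identityʳ _)) ⟨
    d 1 * d 0 - u 0 * l 0 * 1#             ≈⟨ +-congʳ (*-congˡ (triDet-1 d u l)) ⟨
    d 1 * triDet 1 d u l - u 0 * l 0 * 1#  ∎
  triDet-expandLast (suc zero) d u l = begin
    triDet 3 d u l
      ≈⟨ triDet-expandFirst 1 d u l ⟩
    d 0 * triDet 2 d′ u′ l′ - u 0 * l 0 * triDet 1 d″ u″ l″
      ≈⟨ +-cong (*-congˡ (triDet-2 d′ u′ l′)) (-‿cong (*-congˡ (triDet-1 d″ u″ l″))) ⟩
    d 0 * (d 1 * d 2 - u 1 * l 1) - u 0 * l 0 * d 2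
      ≈⟨ solve 7 (λ d₀ d₁ d₂ u₀ l₀ u₁ l₁ → d₀ :* (d₁ :* d₂ :- u₁ :* l₁) :- u₀ :* l₀ :* d₂
                                        := d₂ :* (d₀ :* d₁ :- u₀ :* l₀) :- u₁ :* l₁ :* d₀) refl
                 (d 0) (d 1) (d 2) (u 0) (l 0) (u 1) (l 1) ⟩
    d 2 * (d 0 * d 1 - u 0 * l 0) - u 1 * l 1 * d 0
      ≈⟨ +-cong (*-congˡ (triDet-2 d u l)) (-‿cong (*-congˡ (triDet-1 d u l))) ⟨
    d 2 * triDet 2 d u l - u 1 * l 1 * triDet 1 d u l ∎
    where
    d′ = shift d ; u′ = shift u ; l′ = shift l
    d″ = shift d′ ; u″ = shift u′ ; l″ = shift l′
  triDet-expandLast (suc (suc n)) d u l = begin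
    triDet (4 ℕ.+ n) d u l
      ≈⟨ triDet-expandFirst (2 ℕ.+ n) d u l ⟩
    d 0 * triDet (3 ℕ.+ n) d′ u′ l′ - u 0 * l 0 * triDet (2 ℕ.+ n) d″ u″ l″
      ≈⟨ +-cong (*-congˡ (triDet-expandLast (suc n) d′ u′ l′)) (-‿cong (*-congˡ (triDet-expandLast n d″ u″ l″))) ⟩
    d 0 * (dₙ * triDet (2 ℕ.+ n) d′ u′ l′ - uₙ * lₙ * triDet (suc n) d′ u′ l′)
      - u 0 * l 0 * (dₙ * triDet (suc n) d″ u″ l″ - uₙ * lₙ * triDet n d″ u″ l″)
      ≈⟨ regroup (d 0) (u 0) (l 0) dₙ uₙ lₙ _ _ _ _ ⟩
    dₙ * (d 0 * triDet (2 ℕ.+ n) d′ u′ l′ - u 0 * l 0 * triDet (suc n) d″ u″ l″)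
      - uₙ * lₙ * (d 0 * triDet (suc n) d′ u′ l′ - u 0 * l 0 * triDet n d″ u″ l″)
      ≈⟨ +-cong (*-congˡ (triDet-expandFirst (suc n) d u l)) (-‿cong (*-congˡ (triDet-expandFirst n d u l))) ⟨
    dₙ * triDet (3 ℕ.+ n) d u l - uₙ * lₙ * triDet (2 ℕ.+ n) d u l ∎
    where
    d′ = shift d ; u′ = shift u ; l′ = shift l
    d″ = shift d′ ; u″ = shift u′ ; l″ = shift l′
    dₙ = d (3 ℕ.+ n) ; uₙ = u (2 ℕ.+ n) ; lₙ = l (2 ℕ.+ n)
    regroup : ∀ d₀ u₀ l₀ dₙ uₙ lₙ x y z w →
      d₀ * (dₙ * x - uₙ * lₙ * y) - u₀ * l₀ * (dₙ * z - uₙ * lₙ * w)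
        ≈ dₙ * (d₀ * x - u₀ * l₀ * z) - uₙ * lₙ * (d₀ * y - u₀ * l₀ * w)
    regroup = solve 10 (λ d₀ u₀ l₀ dₙ uₙ lₙ x y z w →
      d₀ :* (dₙ :* x :- uₙ :* lₙ :* y) :- u₀ :* l₀ :* (dₙ :* z :- uₙ :* lₙ :* w)
        := dₙ :* (d₀ :* x :- u₀ :* l₀ :* z) :- uₙ :* lₙ :* (d₀ :* y :- u₀ :* l₀ :* w)) refl

module BlockEntries {c ℓ : Level} (R : CommutativeRing c ℓ) (a b p q : ℕ → CommutativeRing.Carrier R) where
  open CommutativeRing R renaming (Carrier to C) hiding (zero)

  -- blockEntry R a b p q r s is definitionally entryOfBlocks (r / 2) (s / 2) (r % 2) (s % 2).
  entryOfBlocks : (i j x y : ℕ) → C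
  entryOfBlocks i j x y =
    if i ≡ᵇ j then (if x ≡ᵇ y then a i else b i)
    else if j ≡ᵇ suc i then p i
    else if i ≡ᵇ suc j then q j
    else 0#

  private
    E = blockEntry R a b p q

  blockEntry-shift : ∀ x y → E (2 ℕ.+ x) (2 ℕ.+ y) ≡ blockEntry R (shift a) (shift b) (shift p) (shift q) x y
  blockEntry-shift x y =
    ≡.cong₂ (λ i j → entryOfBlocks i j (x % 2) (y % 2)) ([2+m]/2≡1+m/2 x) ([2+m]/2≡1+m/2 y)

  blockEntry-rows₀₁ : ∀ y → E 0 (2 ℕ.+ y) ≡ E 1 (2 ℕ.+ y)
  blockEntry-rows₀₁ y = ≡.trans (≡.cong (λ j → entryOfBlocks 0 j 0 (y % 2)) ([2+m]/2≡1+m/2 y))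
                                (≡.sym (≡.cong (λ j → entryOfBlocks 0 j 1 (y % 2)) ([2+m]/2≡1+m/2 y)))

  blockEntry-columns₀₁ : ∀ x → E (2 ℕ.+ x) 0 ≡ E (2 ℕ.+ x) 1
  blockEntry-columns₀₁ x = ≡.trans (≡.cong (λ i → entryOfBlocks i 0 (x % 2) 0) ([2+m]/2≡1+m/2 x))
                                   (≡.sym (≡.cong (λ i → entryOfBlocks i 0 (x % 2) 1) ([2+m]/2≡1+m/2 x)))

  blockEntry-row₁-far : ∀ y → E 1 (4 ℕ.+ y) ≡ 0#
  blockEntry-row₁-far y = ≡.cong (λ j → entryOfBlocks 0 j 1 (y % 2)) ([4+m]/2≡2+m/2 y)

  blockEntry-column₁-far : ∀ x → E (4 ℕ.+ x) 1 ≡ 0#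
  blockEntry-column₁-far x = ≡.cong (λ i → entryOfBlocks i 0 (x % 2) 1) ([4+m]/2≡2+m/2 x)

module BlockTridiagonal {c ℓ : Level} (R : CommutativeRing c ℓ) where
  open CommutativeRing R renaming (Carrier to C) hiding (zero)
  open IntegerCoefficients R
  open Laplace R
  open Tridiagonal R
  open import Relation.Binary.Reasoning.Setoid setoid

  gdet-expand : ∀ n a b p q →
    gdet R (2 ℕ.+ n) a b p q
      ≈ (a 0 - b 0) * ((a 0 + b 0) * gdet R (suc n) (shift a) (shift b) (shift p) (shift q)
                       - four R * p 0 * q 0 * (a 1 - b 1)
                         * gdet R n (shift (shift a)) (shift (shift b)) (shift (shift p)) (shift (shift q)))
  gdet-expand n a b p q = begin
    det R (4 ℕ.+ k) T
      ≈⟨ det-subtractRow₁ (2 ℕ.+ k) T (λ s → reflexive (E.blockEntry-rows₀₁ (toℕ s))) ⟩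
    (a 0 - b 0) * det R (3 ℕ.+ k) m₀ - (b 0 - a 0) * det R (3 ℕ.+ k) m₁
      ≈⟨ factor (a 0) (b 0) _ _ ⟩
    (a 0 - b 0) * (det R (3 ℕ.+ k) m₀ + det R (3 ℕ.+ k) m₁)
      ≈⟨ *-congˡ merge ⟨
    (a 0 - b 0) * det R (3 ℕ.+ k) N
      ≈⟨ *-congˡ (det-expand₃ k N λ s → trans (+-cong (far s) (far s)) (+-identityʳ 0#)) ⟩
    (a 0 - b 0) * ((a 0 + b 0) * det R (2 ℕ.+ k) (minor N zero)
                   - (p 0 + p 0) * det R (2 ℕ.+ k) (minor N (suc zero))
                   + (p 0 + p 0) * det R (2 ℕ.+ k) (minor N (suc (suc zero))))
      ≈⟨ *-congˡ (+-cong (+-cong (*-congˡ N₀) (-‿cong (*-congˡ N₁))) (*-congˡ N₂)) ⟩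
    (a 0 - b 0) * ((a 0 + b 0) * g′ - (p 0 + p 0) * ((a 1 - b 1) * q 0 * g″)
                   + (p 0 + p 0) * ((b 1 - a 1) * q 0 * g″))
      ≈⟨ *-congˡ (collect (a 0 + b 0) (p 0) (q 0) (a 1) (b 1) g′ g″) ⟩
    (a 0 - b 0) * ((a 0 + b 0) * g′ - four R * p 0 * q 0 * (a 1 - b 1) * g″) ∎
    where
    module E = BlockEntries R a b p q
    module E′ = BlockEntries R (shift a) (shift b) (shift p) (shift q)
    k = n ℕ.* 2
    T = Tmat R (2 ℕ.+ n) a b p q
    m₀ m₁ N : Mat R (3 ℕ.+ k)
    m₀ = minor T zero
    m₁ = minor T (suc zero)
    N = zipWith _+_ (m₀ zero) (m₁ zero) ∷ tail m₀
    g′ = gdet R (suc n) (shift a) (shift b) (shift p) (shift q)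
    g″ = gdet R n (shift (shift a)) (shift (shift b)) (shift (shift p)) (shift (shift q))

    far : ∀ s → T (suc zero) (suc (suc (suc (suc s)))) ≈ 0#
    far s = reflexive (E.blockEntry-row₁-far (toℕ s))

    merge : det R (3 ℕ.+ k) N ≈ det R (3 ℕ.+ k) m₀ + det R (3 ℕ.+ k) m₁
    merge = trans (det-+-row₀ (2 ℕ.+ k) (m₀ zero) (m₁ zero) (tail m₀))
                  (+-cong (det-cong (3 ℕ.+ k) {m₀ zero ∷ tail m₀} {m₀} λ { zero s → refl ; (suc r) s → refl })
                          (det-cong (3 ℕ.+ k) {m₁ zero ∷ tail m₀} {m₁} λ
                            { zero s → refl
                            ; (suc r) zero → sym (reflexive (E.blockEntry-columns₀₁ (toℕ r)))
                            ; (suc r) (suc s) → refl }))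

    N₀ : det R (2 ℕ.+ k) (minor N zero) ≈ g′
    N₀ = det-cong (2 ℕ.+ k) λ r s → reflexive (E.blockEntry-shift (toℕ r) (toℕ s))

    rows₂₃ : ∀ y → T (suc (suc zero)) (suc (suc (suc (suc y))))
                 ≈ T (suc (suc (suc zero))) (suc (suc (suc (suc y))))
    rows₂₃ y = reflexive (≡.trans (E.blockEntry-shift 0 (2 ℕ.+ toℕ y))
                         (≡.trans (E′.blockEntry-rows₀₁ (toℕ y)) (≡.sym (E.blockEntry-shift 1 (2 ℕ.+ toℕ y)))))

    column₁-far : ∀ r → T (suc (suc (suc (suc r)))) (suc zero) ≈ 0#
    column₁-far r = reflexive (E.blockEntry-column₁-far (toℕ r))

    lowerRight : det R k (λ r s → T (suc (suc (suc (suc r)))) (suc (suc (suc (suc s))))) ≈ g″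
    lowerRight = det-cong k λ r s → reflexive (≡.trans (E.blockEntry-shift (2 ℕ.+ toℕ r) (2 ℕ.+ toℕ s))
                                                       (E′.blockEntry-shift (toℕ r) (toℕ s)))

    N₁ : det R (2 ℕ.+ k) (minor N (suc zero)) ≈ (a 1 - b 1) * q 0 * g″
    N₁ = trans (det-nearlyEqualRows k (minor N (suc zero)) refl rows₂₃ column₁-far) (*-congˡ lowerRight)

    N₂ : det R (2 ℕ.+ k) (minor N (suc (suc zero))) ≈ (b 1 - a 1) * q 0 * g″
    N₂ = trans (det-nearlyEqualRows k (minor N (suc (suc zero))) refl rows₂₃ column₁-far) (*-congˡ lowerRight)

    factor : ∀ x y u v → (x - y) * u - (y - x) * v ≈ (x - y) * (u + v)
    factor = solve 4 (λ x y u v → (x :- y) :* u :- (y :- x) :* v := (x :- y) :* (u :+ v)) refl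

    collect : ∀ s p₀ q₀ a₁ b₁ g′ g″ →
      s * g′ - (p₀ + p₀) * ((a₁ - b₁) * q₀ * g″) + (p₀ + p₀) * ((b₁ - a₁) * q₀ * g″)
        ≈ s * g′ - four R * p₀ * q₀ * (a₁ - b₁) * g″
    collect = solve 7 (λ s p₀ q₀ a₁ b₁ g′ g″ →
      s :* g′ :- (p₀ :+ p₀) :* ((a₁ :- b₁) :* q₀ :* g″) :+ (p₀ :+ p₀) :* ((b₁ :- a₁) :* q₀ :* g″)
        := s :* g′ :- con (+ 2) :* con (+ 2) :* p₀ :* q₀ :* (a₁ :- b₁) :* g″) refl

  prodTo-shift : ∀ n f → prodTo R (suc n) f ≈ f 0 * prodTo R n (shift f)
  prodTo-shift zero    f = *-comm 1# (f 0)
  prodTo-shift (suc n) f = trans (*-congʳ (prodTo-shift n f)) (*-assoc _ _ _)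

  private
    twice-twice : ∀ x y → two R * x * (two R * y) ≈ four R * x * y
    twice-twice = solve 2 (λ x y → con (+ 2) :* x :* (con (+ 2) :* y) := con (+ 2) :* con (+ 2) :* x :* y) refl

  htilde-1 : ∀ a b p q → htilde R 1 a b p q ≈ a 0 + b 0
  htilde-1 a b p q = triDet-1 (λ i → a i + b i) (λ i → two R * p i) (λ i → two R * q i)

  htilde-expandFirst : ∀ n a b p q →
    htilde R (2 ℕ.+ n) a b p q
      ≈ (a 0 + b 0) * htilde R (suc n) (shift a) (shift b) (shift p) (shift q)
        - four R * p 0 * q 0 * htilde R n (shift (shift a)) (shift (shift b)) (shift (shift p)) (shift (shift q))
  htilde-expandFirst n a b p q =
    trans (triDet-expandFirst n (λ i → a i + b i) (λ i → two R * p i) (λ i → two R * q i))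
          (+-congˡ (-‿cong (*-congʳ (twice-twice (p 0) (q 0)))))

  htilde-expandLast : ∀ n a b p q →
    htilde R (2 ℕ.+ n) a b p q
      ≈ (a (suc n) + b (suc n)) * htilde R (suc n) a b p q - four R * p n * q n * htilde R n a b p q
  htilde-expandLast n a b p q =
    trans (triDet-expandLast n (λ i → a i + b i) (λ i → two R * p i) (λ i → two R * q i))
          (+-congˡ (-‿cong (*-congʳ (twice-twice (p n) (q n)))))

  gdet≈htilde*prod : ∀ n a b p q → gdet R n a b p q ≈ htilde R n a b p q * prodTo R n (λ i → a i - b i)
  gdet≈htilde*prod zero          a b p q = sym (*-identityˡ 1#)
  gdet≈htilde*prod (suc zero)    a b p q =
    solve 2 (λ x y → con (+ 1) :* x :* (con (+ 1) :* x :* con (+ 1) :+ con (+ 0))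
                     :+ (:- con (+ 1) :* y :* (con (+ 1) :* y :* con (+ 1) :+ con (+ 0)) :+ con (+ 0))
                   := (con (+ 1) :* (x :+ y) :* con (+ 1) :+ con (+ 0)) :* (con (+ 1) :* (x :- y))) refl
            (a 0) (b 0)
  gdet≈htilde*prod (suc (suc n)) a b p q = begin
    gdet R (2 ℕ.+ n) a b p q
      ≈⟨ gdet-expand n a b p q ⟩
    (a 0 - b 0) * ((a 0 + b 0) * gdet R (suc n) a′ b′ p′ q′
                   - four R * p 0 * q 0 * (a 1 - b 1) * gdet R n a″ b″ p″ q″)
      ≈⟨ *-congˡ (+-cong (*-congˡ (trans (gdet≈htilde*prod (suc n) a′ b′ p′ q′)
                                         (*-congˡ (prodTo-shift n (shift f)))))
                         (-‿cong (*-congˡ (gdet≈htilde*prod n a″ b″ p″ q″)))) ⟩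
    (a 0 - b 0) * ((a 0 + b 0) * (h′ * ((a 1 - b 1) * P″)) - four R * p 0 * q 0 * (a 1 - b 1) * (h″ * P″))
      ≈⟨ regroup (a 0) (b 0) (p 0) (q 0) (a 1 - b 1) h′ h″ P″ ⟩
    ((a 0 + b 0) * h′ - four R * p 0 * q 0 * h″) * ((a 0 - b 0) * ((a 1 - b 1) * P″))
      ≈⟨ *-cong (htilde-expandFirst n a b p q)
                (trans (prodTo-shift (suc n) f) (*-congˡ (prodTo-shift n (shift f)))) ⟨
    htilde R (2 ℕ.+ n) a b p q * prodTo R (2 ℕ.+ n) f ∎
    where
    a′ = shift a ; b′ = shift b ; p′ = shift p ; q′ = shift q
    a″ = shift a′ ; b″ = shift b′ ; p″ = shift p′ ; q″ = shift q′
    f : ℕ → C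
    f i = a i - b i
    h′ = htilde R (suc n) a′ b′ p′ q′
    h″ = htilde R n a″ b″ p″ q″
    P″ = prodTo R n (shift (shift f))
    regroup : ∀ a₀ b₀ p₀ q₀ δ₁ h′ h″ P″ →
      (a₀ - b₀) * ((a₀ + b₀) * (h′ * (δ₁ * P″)) - four R * p₀ * q₀ * δ₁ * (h″ * P″))
        ≈ ((a₀ + b₀) * h′ - four R * p₀ * q₀ * h″) * ((a₀ - b₀) * (δ₁ * P″))
    regroup = solve 8 (λ a₀ b₀ p₀ q₀ δ₁ h′ h″ P″ →
      (a₀ :- b₀) :* ((a₀ :+ b₀) :* (h′ :* (δ₁ :* P″)) :- con (+ 2) :* con (+ 2) :* p₀ :* q₀ :* δ₁ :* (h″ :* P″))
        := ((a₀ :+ b₀) :* h′ :- con (+ 2) :* con (+ 2) :* p₀ :* q₀ :* h″) :* ((a₀ :- b₀) :* (δ₁ :* P″))) refl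

theorem2p6 : ∀ {c ℓ : Level} (R : CommutativeRing c ℓ) →
    let open CommutativeRing R renaming (Carrier to C) in
    (a b p q : ℕ → C) →
    ((n : ℕ) → 1 ≤ n → (∀ i → i < n → ¬ (a i * a i - b i * b i ≈ 0#)) →
      gdet R n a b p q ≈ htilde R n a b p q * prodTo R n (λ i → a i - b i))
    × (htilde R 0 a b p q ≈ 1#)
    × (htilde R 1 a b p q ≈ a 0 + b 0)
    × ((n : ℕ) →
        htilde R (suc (suc n)) a b p q
          ≈ (a (suc n) + b (suc n)) * htilde R (suc n) a b p q
            - four R * p n * q n * htilde R n a b p q)
theorem2p6 R a b p q =
    (λ n _ _ → gdet≈htilde*prod n a b p q)
  , CommutativeRing.refl R
  , htilde-1 a b p q
  , λ n → htilde-expandLast n a b p q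
  where open BlockTridiagonal R
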